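{- Let $\mathcal A$ be an MCS satisfying Condition G. Then $\mathcal A$ is $\pi$-terminating.
   Context: Fix variables $x_1,\dots,x_n$, primed copies $x_i'$. An MC is a conjunction of constraints $x\bowtie y$ ($x,y\in\{x_i,x_i'\}$, ${\bowtie}\in\{>,\ge,=\}$). An MCS $\mathcal A$: a finite directed multigraph on flow-points $F$ with arcs labelled by MCs ($G:f\to g$) and invariants $I_f$ (conjunctions of order constraints among $x_1,\dots,x_n$). States $(f,\sigma)$, $\sigma:\{1..n\}\to\mathbb Z$; for $G:f\to g$, $(f,\sigma)\mapsto(g,\sigma')$ is a transition if $\sigma\models I_f$, $\sigma'\models I_g$, $\sigma,\sigma'\models G$. $\pi$-terminating: there is no infinite sequence of states linked by transitions. MCs are graphs on nodes $x_i,x_i'$ (arc $x\to y$ strict for $x>y$, non-strict for $x\ge y$), identified with their consequence closures. The multipath of a CFG path $f_0\xrightarrow{G_1}f_1\xrightarrow{G_2}\cdots$ is the graph with nodes $x[t,i]$ containing, for each $t\ge1$, the arcs of $G_t$ with $x_i\mapsto x[t-1,i]$, $x_j'\mapsto x[t,j]$. A down-path is a sequence of nodes $v_0,v_1,\dots$ with an arc from $v_{j-1}$ to $v_j$ for each $j$; an up-path is a sequence with an arc from $v_j$ to $v_{j-1}$ for each $j$. $\mathcal A$ satisfies Condition G if every infinite multipath $M$ contains an up-path $(x[L_j,l_j])_{j\ge0}$ and a down-path $(x[H_j,h_j])_{j\ge0}$, at least one of which has infinitely many strict arcs, such that for infinitely many $k$ there is a path in $M$ from $x[H_k,h_k]$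 to $x[L_k,l_k]$. -}

module Defs where

open import Data.Nat using (ℕ; suc; _≤_)
open import Data.Integer as ℤ using (ℤ)
open import Data.Fin using (Fin)
open import Data.Bool using (Bool; true; false)
open import Data.List using (List)
open import Data.List.Relation.Unary.All using (All)
open import Data.Product using (Σ; ∃; _×_; _,_; proj₁; proj₂)
open import Data.Sum using (_⊎_)
open import Relation.Nullary using (¬_)
open import Relation.Binary.PropositionalEquality using (_≡_)

data Rel : Set where
  gt ge eq : Rel

-- Variables x_i (un i) and primed copies x_i' (pr i)
data Var (n : ℕ) : Set where
  un pr : Fin n → Var n

record Con (n : ℕ) : Set where
  constructor _⟨_⟩_
  field
    lhs : Var n
    rel : Rel
    rhs : Var n

MC : ℕ → Set
MC n = List (Con n)

Inv : ℕ → Set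
Inv n = List (Fin n × Rel × Fin n)

Assignment : ℕ → Set
Assignment n = Fin n → ℤ

holdsRel : Rel → ℤ → ℤ → Set
holdsRel gt a b = b ℤ.< a
holdsRel ge a b = b ℤ.≤ a
holdsRel eq a b = a ≡ b

val : ∀ {n} → Assignment n → Assignment n → Var n → ℤ
val σ σ' (un i) = σ i
val σ σ' (pr i) = σ' i

SatCon : ∀ {n} → Assignment n → Assignment n → Con n → Set
SatCon σ σ' (x ⟨ r ⟩ y) = holdsRel r (val σ σ' x) (val σ σ' y)

SatMC : ∀ {n} → Assignment n → Assignment n → MC n → Set
SatMC σ σ' G = All (SatCon σ σ') G

SatInv : ∀ {n} → Assignment n → Inv n → Set
SatInv σ I = All (λ { (i , r , j) → holdsRel r (σ i) (σ j) }) I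

-- c belongs to the consequence closure of G
_⊢_ : ∀ {n} → MC n → Con n → Set
_⊢_ {n} G c = (σ σ' : Assignment n) → SatMC σ σ' G → SatCon σ σ' c

-- A monotonicity constraint system: flow points Fin numFP, arcs Fin numArcs
-- (a finite multigraph), each arc labelled by an MC, and invariants I_f.
record MCS (n : ℕ) : Set where
  field
    numFP   : ℕ
    numArcs : ℕ
    src     : Fin numArcs → Fin numFP
    tgt     : Fin numArcs → Fin numFP
    label   : Fin numArcs → MC n
    inv     : Fin numFP → Inv n

module _ {n : ℕ} (𝒜 : MCS n) where
  open MCS 𝒜

  State : Set
  State = Fin numFP × Assignment n

  Transition : Fin numArcs → State → State → Set
  Transition a (f , σ) (g , σ') =
    src a ≡ f × tgt a ≡ g × SatInv σ (inv f) × SatInv σ' (inv g) × SatMC σ σ' (label a)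

  PiTerminating : Set
  PiTerminating =
    ¬ (Σ (ℕ → State) λ s → ∀ t → ∃ λ a → Transition a (s t) (s (suc t)))

  -- An infinite CFG path: arcs a 0, a 1, ... (a t is G_{t+1}), consecutive
  CFGPath : Set
  CFGPath = Σ (ℕ → Fin numArcs) λ a → ∀ t → tgt (a t) ≡ src (a (suc t))

  Node : Set
  Node = ℕ × Fin n

  place : ℕ → Var n → Node
  place t (un i) = t , i
  place t (pr j) = suc t , j

  -- Arcs of the multipath of the arc sequence a; Bool = strictness
  -- (true = strict arc, from x > y; false = non-strict arc, from x ≥ y),
  -- taken from the consequence closure of each G_{t+1}.
  data MArc (a : ℕ → Fin numArcs) : Node → Node → Bool → Set where
    strictArc    : ∀ t (x y : Var n) → label (a t) ⊢ (x ⟨ gt ⟩ y) →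
                   MArc a (place t x) (place t y) true
    nonstrictArc : ∀ t (x y : Var n) → label (a t) ⊢ (x ⟨ ge ⟩ y) →
                   MArc a (place t x) (place t y) false

  data Reach (a : ℕ → Fin numArcs) : Node → Node → Set where
    here : ∀ {u} → Reach a u u
    step : ∀ {u v w b} → MArc a u v b → Reach a v w → Reach a u w

  DownPath : (ℕ → Fin numArcs) → Set
  DownPath a = Σ (ℕ → Node) λ v → Σ (ℕ → Bool) λ s →
               ∀ j → MArc a (v j) (v (suc j)) (s j)

  UpPath : (ℕ → Fin numArcs) → Set
  UpPath a = Σ (ℕ → Node) λ v → Σ (ℕ → Bool) λ s →
             ∀ j → MArc a (v (suc j)) (v j) (s j)

  InfinitelyMany : (ℕ → Set) → Set
  InfinitelyMany P = ∀ m → ∃ λ k → m ≤ k × P k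

  ConditionG : Set
  ConditionG = (p : CFGPath) →
    let a = proj₁ p in
    Σ (UpPath a) λ up → Σ (DownPath a) λ down →
      (InfinitelyMany (λ j → proj₁ (proj₂ up) j ≡ true)
        ⊎ InfinitelyMany (λ j → proj₁ (proj₂ down) j ≡ true))
      × InfinitelyMany (λ k → Reach a (proj₁ down k) (proj₁ up k))

-- Along an infinite run, every node x[t,i] of the multipath of the run's
-- arcs carries the integer value σ_t(i), and every arc u → v of the
-- multipath forces value v ≤ value u (strictly for strict arcs).  The
-- up-path of Condition G is therefore nondecreasing, the down-path
-- nonincreasing, and the infinitely many connecting paths make every value
-- on the up-path at most every value on the down-path.  So both are bounded,
-- yet one of them moves strictly infinitely often: impossible in ℤ.
module Submission where

open import Data.Nat using (ℕ)
open import Defs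

open import Data.Nat as ℕ using (suc; _⊔_; _≤′_; ≤′-refl; ≤′-step)
import Data.Nat.Properties as ℕ
open import Data.Integer as ℤ using (ℤ; +_; -[1+_]; -_; _-_; ∣_∣)
open import Data.Integer.Properties
open import Data.Fin using (Fin)
open import Data.Bool using (Bool; true; false)
open import Data.Product using (∃; _×_; _,_; proj₁; proj₂)
open import Data.Sum using (_⊎_; inj₁; inj₂)
open import Data.Empty using (⊥)
open import Function using (flip; _$_)
open import Relation.Binary.Definitions using (Reflexive; Transitive)
open import Relation.Binary.PropositionalEquality using (_≡_; refl; sym; trans; subst₂)

-- Agrees definitionally with InfinitelyMany 𝒜, whose 𝒜 is only a parameter.
InfinitelyOften : (ℕ → Set) → Set
InfinitelyOften P = ∀ m → ∃ λ k → m ℕ.≤ k × P k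

infinitely-often-map : {P Q : ℕ → Set} → (∀ k → P k → Q k) →
                       InfinitelyOften P → InfinitelyOften Q
infinitely-often-map P⇒Q often m with often m
... | k , m≤k , Pk = k , m≤k , P⇒Q k Pk

stepwise⇒monotone : ∀ {a ℓ} {A : Set a} (_∼_ : A → A → Set ℓ) →
                    Reflexive _∼_ → Transitive _∼_ → (f : ℕ → A) →
                    (∀ j → f j ∼ f (suc j)) → ∀ {j k} → j ℕ.≤ k → f j ∼ f k
stepwise⇒monotone _∼_ refl′ trans′ f f-step j≤k = go (ℕ.≤⇒≤′ j≤k)
  where
  go : ∀ {j k} → j ≤′ k → f j ∼ f k
  go ≤′-refl       = refl′
  go (≤′-step j≤k) = trans′ (go j≤k) (f-step _)

i≤+∣i∣ : ∀ i → i ℤ.≤ + ∣ i ∣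
i≤+∣i∣ (+ n)    = ≤-refl
i≤+∣i∣ -[1+ n ] = ℤ.-≤+

module _ {f : ℕ → ℤ} (f-step : ∀ j → f j ℤ.≤ f (suc j)) where

  nondecreasing : ∀ {j k} → j ℕ.≤ k → f j ℤ.≤ f k
  nondecreasing = stepwise⇒monotone ℤ._≤_ ≤-refl ≤-trans f f-step

  increments-accumulate : InfinitelyOften (λ k → f k ℤ.< f (suc k)) →
                          ∀ m → ∃ λ j → + m ℤ.≤ f j - f 0
  increments-accumulate inc ℕ.zero = 0 , ≤-reflexive (sym (+-inverseʳ (f 0)))
  increments-accumulate inc (suc m) with increments-accumulate inc m
  ... | j , m≤fj-f0 with inc j
  ... | k , j≤k , fk<fk+1 =
    suc k , i<j⇒suc[i]≤j (begin-strict
      + m             ≤⟨ m≤fj-f0 ⟩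
      f j - f 0       ≤⟨ +-monoˡ-≤ (- f 0) (nondecreasing j≤k) ⟩
      f k - f 0       <⟨ +-monoˡ-< (- f 0) fk<fk+1 ⟩
      f (suc k) - f 0 ∎)
    where open ≤-Reasoning

  bounded⇒¬infinitely-increasing :
    ∀ B → (∀ j → f j ℤ.≤ B) → InfinitelyOften (λ k → f k ℤ.< f (suc k)) → ⊥
  bounded⇒¬infinitely-increasing B f≤B inc
    with increments-accumulate inc (suc ∣ B - f 0 ∣)
  ... | j , gap<fj-f0 = <-irrefl refl $ begin-strict
    + ∣ B - f 0 ∣ <⟨ suc[i]≤j⇒i<j gap<fj-f0 ⟩
    f j - f 0     ≤⟨ +-monoˡ-≤ (- f 0) (f≤B j) ⟩
    B - f 0       ≤⟨ i≤+∣i∣ (B - f 0) ⟩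
    + ∣ B - f 0 ∣ ∎
    where open ≤-Reasoning

linked-monotone-sequences-separated :
  {u w : ℕ → ℤ} → (∀ j → u j ℤ.≤ u (suc j)) → (∀ j → w (suc j) ℤ.≤ w j) →
  InfinitelyOften (λ k → u k ℤ.≤ w k) → ∀ i j → u i ℤ.≤ w j
linked-monotone-sequences-separated {u} {w} u-step w-step linked i j
  with linked (i ⊔ j)
... | k , i⊔j≤k , uk≤wk = begin
  u i ≤⟨ nondecreasing u-step (ℕ.≤-trans (ℕ.m≤m⊔n i j) i⊔j≤k) ⟩
  u k ≤⟨ uk≤wk ⟩
  w k ≤⟨ w-nonincreasing (ℕ.≤-trans (ℕ.m≤n⊔m i j) i⊔j≤k) ⟩
  w j ∎
  where
  open ≤-Reasoning
  w-nonincreasing : ∀ {j k} → j ℕ.≤ k → w k ℤ.≤ w j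
  w-nonincreasing = stepwise⇒monotone (flip ℤ._≤_) ≤-refl (flip ≤-trans) w w-step

module _ {n : ℕ} (𝒜 : MCS n) where
  open MCS 𝒜

  module _ (s : ℕ → State 𝒜) (tr : ∀ t → ∃ λ a → Transition 𝒜 a (s t) (s (suc t))) where

    arcs : ℕ → Fin numArcs
    arcs t = proj₁ (tr t)

    run-path : CFGPath 𝒜
    run-path = arcs , λ t →
      trans (proj₁ (proj₂ (proj₂ (tr t)))) (sym (proj₁ (proj₂ (tr (suc t)))))

    σ : ℕ → Assignment n
    σ t = proj₂ (s t)

    value : Node 𝒜 → ℤ
    value (t , i) = σ t i

    value-place : ∀ t x → val (σ t) (σ (suc t)) x ≡ value (place 𝒜 t x)
    value-place t (un i) = refl
    value-place t (pr j) = refl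

    sat : ∀ t → SatMC (σ t) (σ (suc t)) (label (arcs t))
    sat t = proj₂ (proj₂ (proj₂ (proj₂ (proj₂ (tr t)))))

    placed : ∀ {r} t x y →
             holdsRel r (val (σ t) (σ (suc t)) x) (val (σ t) (σ (suc t)) y) →
             holdsRel r (value (place 𝒜 t x)) (value (place 𝒜 t y))
    placed {r} t x y = subst₂ (holdsRel r) (value-place t x) (value-place t y)

    arc-rel : Bool → Rel
    arc-rel true  = gt
    arc-rel false = ge

    arc-sound : ∀ {u v b} → MArc 𝒜 arcs u v b → holdsRel (arc-rel b) (value u) (value v)
    arc-sound (strictArc    t x y G⊢x>y) = placed t x y (G⊢x>y _ _ (sat t))
    arc-sound (nonstrictArc t x y G⊢x≥y) = placed t x y (G⊢x≥y _ _ (sat t))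

    arc-≥ : ∀ {u v b} → MArc 𝒜 arcs u v b → value v ℤ.≤ value u
    arc-≥ {b = true}  u→v = <⇒≤ (arc-sound u→v)
    arc-≥ {b = false} u→v = arc-sound u→v

    strict-arc-< : ∀ {u v b} → MArc 𝒜 arcs u v b → b ≡ true → value v ℤ.< value u
    strict-arc-< u→v refl = arc-sound u→v

    reach-≥ : ∀ {u w} → Reach 𝒜 arcs u w → value w ℤ.≤ value u
    reach-≥ here          = ≤-refl
    reach-≥ (step u→v v→w) = ≤-trans (reach-≥ v→w) (arc-≥ u→v)

    up-below-down :
      ((v , _ , up-arc) : UpPath 𝒜 arcs) ((w , _ , down-arc) : DownPath 𝒜 arcs) →
      InfinitelyOften (λ k → Reach 𝒜 arcs (w k) (v k)) →
      ∀ i j → value (v i) ℤ.≤ value (w j)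
    up-below-down (v , _ , up-arc) (w , _ , down-arc) linked =
      linked-monotone-sequences-separated
        (λ j → arc-≥ (up-arc j)) (λ j → arc-≥ (down-arc j))
        (infinitely-often-map (λ k → reach-≥) linked)

    conditionG-fails-on-run :
      (up : UpPath 𝒜 arcs) (down : DownPath 𝒜 arcs) →
      InfinitelyOften (λ j → proj₁ (proj₂ up) j ≡ true)
        ⊎ InfinitelyOften (λ j → proj₁ (proj₂ down) j ≡ true) →
      InfinitelyOften (λ k → Reach 𝒜 arcs (proj₁ down k) (proj₁ up k)) → ⊥
    conditionG-fails-on-run up@(v , _ , up-arc) down@(w , _ , down-arc)
                            (inj₁ up-strictly-often) linked =
      bounded⇒¬infinitely-increasing (λ j → arc-≥ (up-arc j)) (value (w 0))
        (λ j → up-below-down up down linked j 0)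
        (infinitely-often-map (λ k → strict-arc-< (up-arc k)) up-strictly-often)
    conditionG-fails-on-run up@(v , _ , up-arc) down@(w , _ , down-arc)
                            (inj₂ down-strictly-often) linked =
      bounded⇒¬infinitely-increasing (λ j → neg-mono-≤ (arc-≥ (down-arc j)))
        (- value (v 0))
        (λ j → neg-mono-≤ (up-below-down up down linked 0 j))
        (infinitely-often-map (λ k strict → neg-mono-< (strict-arc-< (down-arc k) strict))
                              down-strictly-often)

mainTheorem6 : (n : ℕ) (𝒜 : MCS n) → ConditionG 𝒜 → PiTerminating 𝒜
mainTheorem6 n 𝒜 G (s , tr) =
  let (up , down , strict , linked) = G (run-path 𝒜 s tr)
  in  conditionG-fails-on-run 𝒜 s tr up down strict linked
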